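{- For an integer $m\geq 0$ let $P_m$ denote the path with $m$ edges and, for a graph $G$, write $P_m(G)=|\operatorname{Hom}(P_m;G)|$ (so $P_0(G)=n$ if $G$ has $n$ vertices). Suppose that for every graph $G$ and every odd positive integer $t$ one has $P_0(G)^2\,P_{t+2}(G)^{t}\geq P_{t}(G)^{t+2}$. Then for every graph $G$ on $n\geq1$ vertices and all odd positive integers $k\geq t$, one has $w_k(G)^t\geq w_t(G)^k$.
   Context: All graphs are finite. A graph homomorphism from $F$ to $G$ is a map $\varphi:V(F)\to V(G)$ sending edges of $F$ to edges of $G$; $\operatorname{Hom}(F;G)$ is the set of such maps. For a graph $G$ on $n$ vertices, $w_k(G)$ denotes the number of walks of length $k$ (with $k$ edges) in $G$ divided by $n$, i.e. $w_k(G)=P_k(G)/n$. -}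

module Defs where

open import Data.Nat using (ℕ; zero; suc; _*_; NonZero)
open import Data.Bool using (Bool; true; false; _∧_; T)
open import Data.Fin using (Fin)
open import Data.Vec using (Vec; []; _∷_)
open import Data.List using (List; []; _∷_; [_]; map; concatMap; length; filterᵇ; allFin)
open import Data.Product using (Σ)
open import Data.Integer using (+_)
open import Data.Rational using (ℚ; 1ℚ; _/_) renaming (_*_ to _*ℚ_)
open import Relation.Binary.PropositionalEquality using (_≡_)

record Graph : Set where
  field
    n     : ℕ
    adj   : Fin n → Fin n → Bool
    sym   : ∀ u v → adj u v ≡ adj v u
    irref : ∀ v → adj v v ≡ false
open Graph public

-- All maps Fin m → Fin n, represented as vectors of length m.
allVecs : (n m : ℕ) → List (Vec (Fin n) m)
allVecs n zero    = [ [] ]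
allVecs n (suc m) = concatMap (λ v → map (_∷ v) (allFin n)) (allVecs n m)

isHom : (G : Graph) {m : ℕ} → Vec (Fin (n G)) m → Bool
isHom G []                = true
isHom G (x ∷ [])          = true
isHom G (x ∷ y ∷ xs)      = adj G x y ∧ isHom G (y ∷ xs)

-- P_m(G) = |Hom(P_m; G)|, where P_m is the path with m edges (m+1 vertices).
homP : ℕ → Graph → ℕ
homP m G = length (filterᵇ (isHom G) (allVecs (n G) (suc m)))

_^ℚ_ : ℚ → ℕ → ℚ
q ^ℚ zero  = 1ℚ
q ^ℚ suc k = q *ℚ (q ^ℚ k)

w : ℕ → (G : Graph) → .{{NonZero (n G)}} → ℚ
w k G = (+ homP k G) / n G

Odd : ℕ → Set
Odd t = Σ ℕ (λ s → t ≡ suc (2 * s))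

-- Put x_k = w_k(G) ≥ 0 and read x_t ^ k ≤ x_k ^ t as x_t^(1/t) ≤ x_k^(1/k).  Dividing the
-- hypothesis by n^(k+2) (using P_0(G) = n) turns it into x_k^(1/k) ≤ x_(k+2)^(1/(k+2)) for odd k,
-- and these steps chain from t to k because ≤ between roots is transitive: raise both
-- inequalities to a common power and take a k-th root, which is monotone on ℚ≥0.
module Submission where

open import Defs hiding (sym)
open import Data.Nat as ℕ using (ℕ; zero; suc; _+_; _*_; _^_; _≤_; NonZero)
import Data.Nat.Properties as ℕ
open import Data.Nat.Solver using (module +-*-Solver)
open +-*-Solver using (solve; _:*_; _:=_)
open import Data.Integer as ℤ using (+_; +≤+)
import Data.Integer.Properties as ℤ
open import Data.Rational as ℚ using (ℚ; 0ℚ; 1ℚ; toℚᵘ) renaming (_≤_ to _≤ℚ_)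
import Data.Rational.Properties as ℚ
open import Data.Rational.Unnormalised as ℚᵘ using (mkℚᵘ; *≤*) renaming (_/_ to _/ᵘ_)
import Data.Rational.Unnormalised.Properties as ℚᵘ
open import Data.Product using (∃; _,_)
open import Data.List using (length; filterᵇ; map; allFin; _++_; []; _∷_)
import Data.List.Properties as List
open import Data.Vec using ([_])
open import Relation.Nullary using (yes; no; contradiction)
open import Relation.Binary.PropositionalEquality
  using (_≡_; refl; sym; trans; cong; subst₂; module ≡-Reasoning)

private
  variable
    p q : ℚ
    k t : ℕ

^ℚ-distribˡ-+-* : ∀ p m n → p ^ℚ (m + n) ≡ p ^ℚ m ℚ.* p ^ℚ n
^ℚ-distribˡ-+-* p zero    n = sym (ℚ.*-identityˡ (p ^ℚ n))
^ℚ-distribˡ-+-* p (suc m) n = trans (cong (p ℚ.*_) (^ℚ-distribˡ-+-* p m n)) (sym (ℚ.*-assoc p _ _))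

^ℚ-*-assoc : ∀ p m n → (p ^ℚ m) ^ℚ n ≡ p ^ℚ (m * n)
^ℚ-*-assoc p m zero    = cong (p ^ℚ_) (sym (ℕ.*-zeroʳ m))
^ℚ-*-assoc p m (suc n) = begin
  p ^ℚ m ℚ.* (p ^ℚ m) ^ℚ n  ≡⟨ cong (p ^ℚ m ℚ.*_) (^ℚ-*-assoc p m n) ⟩
  p ^ℚ m ℚ.* p ^ℚ (m * n)   ≡⟨ sym (^ℚ-distribˡ-+-* p m (m * n)) ⟩
  p ^ℚ (m + m * n)          ≡⟨ cong (p ^ℚ_) (sym (ℕ.*-suc m n)) ⟩
  p ^ℚ (m * suc n)          ∎
  where open ≡-Reasoning

^ℚ-comm : ∀ p m n → (p ^ℚ m) ^ℚ n ≡ (p ^ℚ n) ^ℚ m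
^ℚ-comm p m n = begin
  (p ^ℚ m) ^ℚ n  ≡⟨ ^ℚ-*-assoc p m n ⟩
  p ^ℚ (m * n)   ≡⟨ cong (p ^ℚ_) (ℕ.*-comm m n) ⟩
  p ^ℚ (n * m)   ≡⟨ sym (^ℚ-*-assoc p n m) ⟩
  (p ^ℚ n) ^ℚ m  ∎
  where open ≡-Reasoning

^ℚ-nonNeg : 0ℚ ≤ℚ p → ∀ n → 0ℚ ≤ℚ p ^ℚ n
^ℚ-nonNeg     0≤p zero    = ℚ.nonNegative⁻¹ 1ℚ
^ℚ-nonNeg {p} 0≤p (suc n) = ℚ.nonNegative⁻¹ (p ℚ.* p ^ℚ n)
  {{ℚ.nonNeg*nonNeg⇒nonNeg p {{ℚ.nonNegative 0≤p}} (p ^ℚ n) {{ℚ.nonNegative (^ℚ-nonNeg 0≤p n)}}}}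

^ℚ-monoˡ-≤ : 0ℚ ≤ℚ p → p ≤ℚ q → ∀ n → p ^ℚ n ≤ℚ q ^ℚ n
^ℚ-monoˡ-≤         0≤p p≤q zero    = ℚ.≤-refl
^ℚ-monoˡ-≤ {p} {q} 0≤p p≤q (suc n) = begin
  p ℚ.* p ^ℚ n  ≤⟨ ℚ.*-monoʳ-≤-nonNeg (p ^ℚ n) {{ℚ.nonNegative (^ℚ-nonNeg 0≤p n)}} p≤q ⟩
  q ℚ.* p ^ℚ n  ≤⟨ ℚ.*-monoˡ-≤-nonNeg q {{ℚ.nonNegative (ℚ.≤-trans 0≤p p≤q)}} (^ℚ-monoˡ-≤ 0≤p p≤q n) ⟩
  q ℚ.* q ^ℚ n  ∎
  where open ℚ.≤-Reasoning

^ℚ-monoˡ-< : 0ℚ ≤ℚ p → p ℚ.< q → ∀ n → p ^ℚ suc n ℚ.< q ^ℚ suc n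
^ℚ-monoˡ-< {p} {q} 0≤p p<q zero = begin-strict
  p ℚ.* 1ℚ  ≡⟨ ℚ.*-identityʳ p ⟩
  p         <⟨ p<q ⟩
  q         ≡⟨ sym (ℚ.*-identityʳ q) ⟩
  q ℚ.* 1ℚ  ∎
  where open ℚ.≤-Reasoning
^ℚ-monoˡ-< {p} {q} 0≤p p<q (suc n) = begin-strict
  p ℚ.* p ^ℚ suc n  ≤⟨ ℚ.*-monoʳ-≤-nonNeg (p ^ℚ suc n) {{ℚ.nonNegative (^ℚ-nonNeg 0≤p (suc n))}} (ℚ.<⇒≤ p<q) ⟩
  q ℚ.* p ^ℚ suc n  <⟨ ℚ.*-monoʳ-<-pos q {{ℚ.positive (ℚ.≤-<-trans 0≤p p<q)}} (^ℚ-monoˡ-< 0≤p p<q n) ⟩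
  q ℚ.* q ^ℚ suc n  ∎
  where open ℚ.≤-Reasoning

^ℚ-cancelˡ-≤ : ∀ n .{{_ : NonZero n}} → 0ℚ ≤ℚ q → p ^ℚ n ≤ℚ q ^ℚ n → p ≤ℚ q
^ℚ-cancelˡ-≤ {q} {p} (suc n) 0≤q pⁿ≤qⁿ with p ℚ.≤? q
... | yes p≤q = p≤q
... | no  p≰q = contradiction (ℚ.≤-<-trans pⁿ≤qⁿ (^ℚ-monoˡ-< 0≤q (ℚ.≰⇒> p≰q) n)) (ℚ.<-irrefl refl)

-- Read p ^ k ≤ q ^ t as p^(1/t) ≤ q^(1/k): this is transitivity of ≤ between roots.
root-≤-trans : ∀ {p q r} t k m .{{_ : NonZero k}} → 0ℚ ≤ℚ p → 0ℚ ≤ℚ q → 0ℚ ≤ℚ r →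
  p ^ℚ k ≤ℚ q ^ℚ t → q ^ℚ m ≤ℚ r ^ℚ k → p ^ℚ m ≤ℚ r ^ℚ t
root-≤-trans {p} {q} {r} t k m 0≤p 0≤q 0≤r pᵏ≤qᵗ qᵐ≤rᵏ = ^ℚ-cancelˡ-≤ k (^ℚ-nonNeg 0≤r t) (begin
  (p ^ℚ m) ^ℚ k  ≡⟨ ^ℚ-comm p m k ⟩
  (p ^ℚ k) ^ℚ m  ≤⟨ ^ℚ-monoˡ-≤ (^ℚ-nonNeg 0≤p k) pᵏ≤qᵗ m ⟩
  (q ^ℚ t) ^ℚ m  ≡⟨ ^ℚ-comm q t m ⟩
  (q ^ℚ m) ^ℚ t  ≤⟨ ^ℚ-monoˡ-≤ (^ℚ-nonNeg 0≤q m) qᵐ≤rᵏ t ⟩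
  (r ^ℚ k) ^ℚ t  ≡⟨ ^ℚ-comm r k t ⟩
  (r ^ℚ t) ^ℚ k  ∎)
  where open ℚ.≤-Reasoning

-- ℚ's _/_ normalises by the gcd, so identities between fractions are checked on
-- unnormalised representatives.
toℚᵘ-/ : ∀ i d .{{_ : NonZero d}} → toℚᵘ (i ℚ./ d) ℚᵘ.≃ (i /ᵘ d)
toℚᵘ-/ i (suc d) = ℚ.toℚᵘ-fromℚᵘ (mkℚᵘ i d)

/ᵘ-*-/ᵘ : ∀ i j d e .{{_ : NonZero d}} .{{_ : NonZero e}} →
  (i /ᵘ d) ℚᵘ.* (j /ᵘ e) ≡ ((i ℤ.* j) /ᵘ (d * e)) {{ℕ.m*n≢0 d e}}
/ᵘ-*-/ᵘ i j (suc d) (suc e) = refl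

/-^ℚ : ∀ a d .{{_ : NonZero d}} n → (+ a ℚ./ d) ^ℚ n ≡ (+ (a ^ n) ℚ./ d ^ n) {{ℕ.m^n≢0 d n}}
/-^ℚ a d zero    = refl
/-^ℚ a d (suc n) = ℚ.toℚᵘ-injective (begin
  toℚᵘ ((+ a ℚ./ d) ℚ.* (+ a ℚ./ d) ^ℚ n)          ≈⟨ ℚ.toℚᵘ-homo-* (+ a ℚ./ d) _ ⟩
  toℚᵘ (+ a ℚ./ d) ℚᵘ.* toℚᵘ ((+ a ℚ./ d) ^ℚ n)     ≡⟨ cong (λ r → toℚᵘ (+ a ℚ./ d) ℚᵘ.* toℚᵘ r) (/-^ℚ a d n) ⟩
  toℚᵘ (+ a ℚ./ d) ℚᵘ.* toℚᵘ (+ (a ^ n) ℚ./ d ^ n) ≈⟨ ℚᵘ.*-cong (toℚᵘ-/ (+ a) d) (toℚᵘ-/ (+ (a ^ n)) (d ^ n)) ⟩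
  (+ a /ᵘ d) ℚᵘ.* (+ (a ^ n) /ᵘ d ^ n)             ≡⟨ /ᵘ-*-/ᵘ (+ a) (+ (a ^ n)) d (d ^ n) ⟩
  (+ a ℤ.* + (a ^ n)) /ᵘ d ^ suc n                 ≡⟨ cong (λ i → i /ᵘ d ^ suc n) (sym (ℤ.pos-* a (a ^ n))) ⟩
  + (a ^ suc n) /ᵘ d ^ suc n                       ≈⟨ ℚᵘ.≃-sym (toℚᵘ-/ (+ (a ^ suc n)) (d ^ suc n)) ⟩
  toℚᵘ (+ (a ^ suc n) ℚ./ d ^ suc n)               ∎)
  where
  open ℚᵘ.≃-Reasoning
  instance
    dⁿ≢0   = ℕ.m^n≢0 d n
    d¹⁺ⁿ≢0 = ℕ.m^n≢0 d (suc n)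

/ᵘ-≤-/ᵘ : ∀ a b d e .{{_ : NonZero d}} .{{_ : NonZero e}} → a * e ≤ b * d → (+ a /ᵘ d) ℚᵘ.≤ (+ b /ᵘ e)
/ᵘ-≤-/ᵘ a b (suc d) (suc e) ae≤bd = *≤* (subst₂ ℤ._≤_ (ℤ.pos-* a (suc e)) (ℤ.pos-* b (suc d)) (+≤+ ae≤bd))

/-≤-/ : ∀ a b d e .{{_ : NonZero d}} .{{_ : NonZero e}} → a * e ≤ b * d → (+ a ℚ./ d) ≤ℚ (+ b ℚ./ e)
/-≤-/ a b d e ae≤bd = ℚ.toℚᵘ-cancel-≤
  (ℚᵘ.≤-respˡ-≃ (ℚᵘ.≃-sym (toℚᵘ-/ (+ a) d)) (ℚᵘ.≤-respʳ-≃ (ℚᵘ.≃-sym (toℚᵘ-/ (+ b) e)) (/ᵘ-≤-/ᵘ a b d e ae≤bd)))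

/-^ℚ-≤-/-^ℚ : ∀ a b d .{{_ : NonZero d}} m l → a ^ m * d ^ l ≤ b ^ l * d ^ m → (+ a ℚ./ d) ^ℚ m ≤ℚ (+ b ℚ./ d) ^ℚ l
/-^ℚ-≤-/-^ℚ a b d m l ineq = subst₂ _≤ℚ_ (sym (/-^ℚ a d m)) (sym (/-^ℚ b d l))
  (/-≤-/ (a ^ m) (b ^ l) (d ^ m) (d ^ l) {{ℕ.m^n≢0 d m}} {{ℕ.m^n≢0 d l}} ineq)

/-nonNeg : ∀ a d .{{_ : NonZero d}} → 0ℚ ≤ℚ (+ a ℚ./ d)
/-nonNeg a d = ℚ.nonNegative⁻¹ (+ a ℚ./ d) {{ℚ.normalize-nonNeg a d}}

odd⇒nonZero : Odd t → NonZero t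
odd⇒nonZero (s , refl) = _

odd-+-2* : Odd t → ∀ j → Odd (t + 2 * j)
odd-+-2* (s , refl) j = s + j , cong suc (sym (ℕ.*-distribˡ-+ 2 s j))

odd-≤-odd⇒+2* : Odd t → Odd k → t ≤ k → ∃ λ j → k ≡ t + 2 * j
odd-≤-odd⇒+2* (s , refl) (r , refl) t≤k = r ℕ.∸ s , cong suc (begin
  2 * r                 ≡⟨ cong (2 *_) (sym (ℕ.m+[n∸m]≡n s≤r)) ⟩
  2 * (s + (r ℕ.∸ s))   ≡⟨ ℕ.*-distribˡ-+ 2 s (r ℕ.∸ s) ⟩
  2 * s + 2 * (r ℕ.∸ s) ∎)
  where
  open ≡-Reasoning
  s≤r : s ≤ r
  s≤r = ℕ.*-cancelˡ-≤ 2 (ℕ.s≤s⁻¹ t≤k)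

+-2*-suc : ∀ t j → t + 2 * suc j ≡ t + 2 * j + 2
+-2*-suc t j = begin
  t + 2 * suc j    ≡⟨ cong (λ u → t + u) (ℕ.*-suc 2 j) ⟩
  t + (2 + 2 * j)  ≡⟨ cong (λ u → t + u) (ℕ.+-comm 2 (2 * j)) ⟩
  t + (2 * j + 2)  ≡⟨ sym (ℕ.+-assoc t (2 * j) 2) ⟩
  t + 2 * j + 2    ∎
  where open ≡-Reasoning

module _ (x : ℕ → ℚ) (x≥0 : ∀ k → 0ℚ ≤ℚ x k)
         (step : ∀ k → Odd k → x k ^ℚ (k + 2) ≤ℚ x (k + 2) ^ℚ k) where

  root-≤-+2* : Odd t → ∀ j → x t ^ℚ (t + 2 * j) ≤ℚ x (t + 2 * j) ^ℚ t
  root-≤-+2* {t} odd-t zero rewrite ℕ.+-identityʳ t = ℚ.≤-refl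
  root-≤-+2* {t} odd-t (suc j) rewrite +-2*-suc t j =
    root-≤-trans t (t + 2 * j) (t + 2 * j + 2) {{odd⇒nonZero (odd-+-2* odd-t j)}}
      (x≥0 t) (x≥0 (t + 2 * j)) (x≥0 (t + 2 * j + 2))
      (root-≤-+2* odd-t j) (step (t + 2 * j) (odd-+-2* odd-t j))

  root-≤-odd : Odd t → Odd k → t ≤ k → x t ^ℚ k ≤ℚ x k ^ℚ t
  root-≤-odd odd-t odd-k t≤k with j , refl ← odd-≤-odd⇒+2* odd-t odd-k t≤k = root-≤-+2* odd-t j

homP-zero : ∀ G → homP 0 G ≡ n G
homP-zero G = begin
  length (filterᵇ (isHom G) (map [_] (allFin (n G)) ++ []))
    ≡⟨ cong (λ l → length (filterᵇ (isHom G) l)) (List.++-identityʳ (map [_] (allFin (n G)))) ⟩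
  length (filterᵇ (isHom G) (map [_] (allFin (n G))))
    ≡⟨ cong length (filter-singletons (allFin (n G))) ⟩
  length (map [_] (allFin (n G)))
    ≡⟨ List.length-map [_] (allFin (n G)) ⟩
  length (allFin (n G))
    ≡⟨ List.length-tabulate _ ⟩
  n G ∎
  where
  open ≡-Reasoning
  filter-singletons : ∀ vs → filterᵇ (isHom G) (map [_] vs) ≡ map [_] vs
  filter-singletons []       = refl
  filter-singletons (v ∷ vs) = cong ([ v ] ∷_) (filter-singletons vs)

module _ (G : Graph) .{{_ : NonZero (n G)}} where

  w-nonNeg : ∀ k → 0ℚ ≤ℚ w k G
  w-nonNeg k = /-nonNeg (homP k G) (n G)

  w-step : ∀ k → homP k G ^ (k + 2) ≤ (homP 0 G ^ 2) * (homP (k + 2) G ^ k) →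
    w k G ^ℚ (k + 2) ≤ℚ w (k + 2) G ^ℚ k
  w-step k hyp = /-^ℚ-≤-/-^ℚ P Q N (k + 2) k (begin
    P ^ (k + 2) * N ^ k           ≤⟨ ℕ.*-monoˡ-≤ (N ^ k) hyp ⟩
    homP 0 G ^ 2 * Q ^ k * N ^ k  ≡⟨ cong (λ z → z ^ 2 * Q ^ k * N ^ k) (homP-zero G) ⟩
    N ^ 2 * Q ^ k * N ^ k         ≡⟨ solve 3 (λ a b c → a :* b :* c := b :* (c :* a)) refl (N ^ 2) (Q ^ k) (N ^ k) ⟩
    Q ^ k * (N ^ k * N ^ 2)       ≡⟨ cong (Q ^ k *_) (sym (ℕ.^-distribˡ-+-* N k 2)) ⟩
    Q ^ k * N ^ (k + 2)           ∎)
    where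
    open ℕ.≤-Reasoning
    N = n G
    P = homP k G
    Q = homP (k + 2) G

lemma2p1 : ((G : Graph) (t : ℕ) → Odd t →
    homP t G ^ (t + 2) ≤ (homP 0 G ^ 2) * (homP (t + 2) G ^ t)) →
    (G : Graph) .{{_ : NonZero (n G)}} (k t : ℕ) → Odd k → Odd t → t ≤ k →
    (w t G ^ℚ k) ≤ℚ (w k G ^ℚ t)
lemma2p1 hyp G k t odd-k odd-t t≤k =
  root-≤-odd (λ m → w m G) (w-nonNeg G) (λ m odd-m → w-step G m (hyp G m odd-m)) odd-t odd-k t≤k
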